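{- For every integer $k$ with $-1\le k\le 21$ the numerical semigroup ${\sf S}(4,\,6+4k,\,87-4k)$ is symmetric, and for every integer $k$ with $0\le k\le 9$ the numerical semigroup ${\sf S}(9,\,3+9k,\,85-9k)$ is symmetric. (Here the generating triples are not required to be minimal; in some cases the semigroup is generated by two of the three elements.)
   Context: For positive integers $d_1,\dots,d_m$ with $\gcd(d_1,\dots,d_m)=1$, ${\sf S}(d_1,\dots,d_m)=\{\sum_{i=1}^m x_id_i : x_i\in\mathbb{Z}_{\ge 0}\}$, and its Frobenius number $F$ is the largest positive integer not in ${\sf S}(d_1,\dots,d_m)$. The semigroup is called symmetric if for every integer $s$: $s\in{\sf S}(d_1,\dots,d_m)$ if and only if $F-s\notin{\sf S}(d_1,\dots,d_m)$. -}

module Defs where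

open import Data.Nat using (ℕ)
open import Data.Integer using (ℤ; +_; _+_; _*_; _-_; _<_; _≤_)
open import Data.Product using (Σ; ∃; _×_)
open import Relation.Binary.PropositionalEquality using (_≡_)
open import Relation.Nullary using (¬_)
open import Function.Bundles using (_⇔_)

_∈S[_,_,_] : ℤ → ℤ → ℤ → ℤ → Set
s ∈S[ d₁ , d₂ , d₃ ] =
  ∃ λ (x₁ : ℕ) → ∃ λ (x₂ : ℕ) → ∃ λ (x₃ : ℕ) →
    (+ x₁) * d₁ + (+ x₂) * d₂ + (+ x₃) * d₃ ≡ s

IsFrobenius : ℤ → ℤ → ℤ → ℤ → Set
IsFrobenius d₁ d₂ d₃ F =
  (+ 1 ≤ F) × ¬ (F ∈S[ d₁ , d₂ , d₃ ]) × (∀ (n : ℤ) → F < n → n ∈S[ d₁ , d₂ , d₃ ])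

Symmetric : ℤ → ℤ → ℤ → Set
Symmetric d₁ d₂ d₃ =
  ∃ λ (F : ℤ) → IsFrobenius d₁ d₂ d₃ F ×
    (∀ (s : ℤ) → (s ∈S[ d₁ , d₂ , d₃ ]) ⇔ (¬ ((F - s) ∈S[ d₁ , d₂ , d₃ ])))

module Submission where

-- Each of these 33 semigroups is handled by a finite certificate.  For
-- generators a > 0, b, c and a candidate F > 0 it asserts
--   (i)  the a consecutive numbers F+1, …, F+a lie in S, and
--   (ii) for every 0 ≤ s ≤ F exactly one of s and F − s lies in S.
-- Since S is closed under adding a, (i) puts every n > F into S; (ii) at
-- s = 0 shows F ∉ S, so F is the Frobenius number; and (ii) together with
-- closure of S under addition gives "s ∈ S ⇔ F − s ∉ S" for every integer s.
-- Membership of a natural number in S is decidable (peel off multiples of c,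
-- then of b, and test divisibility by a), hence so is the certificate.
--
-- The theorem then follows by
-- evaluating the two families of certificates, whose Frobenius numbers are
-- given by closed formulas.

open import Defs
open import Data.Bool using (Bool; T; _∧_; _∨_)
open import Data.Bool.Properties using (T-∧; T-∨)
open import Data.Nat as ℕ using (ℕ; zero; suc; NonZero)
open import Data.Nat.Properties using (allUpTo?)
open import Data.Product using (∃; ∃₂; _×_; _,_)
open import Data.Sum using (_⊎_; inj₁; inj₂)
open import Data.Unit using (tt)
open import Function using (_∘_)
open import Function.Bundles using (mk⇔; module Equivalence)
open import Relation.Nullary using (¬_; Dec; yes; no; contradiction)
open import Relation.Nullary.Decidable using (⌊_⌋; toWitness; fromWitness; map′; T?; _×-dec_; _⊎-dec_; ¬?)
open import Relation.Unary using (Decidable)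
open import Relation.Binary.PropositionalEquality using (_≡_; refl; sym; trans; cong; cong₂; subst; subst₂; module ≡-Reasoning)

module NaturalMembership where
  open import Data.Nat using (_+_; _*_; _∸_; _≤_; _<_; _≤ᵇ_; _≤?_; _<?_; z≤n; s≤s)
  open import Data.Nat.Properties
    using (+-identityʳ; +-comm; +-assoc; *-zeroʳ; m∸n+n≡m; m+n∸n≡m; m+[n∸m]≡n;
           ≤ᵇ⇒≤; ≤⇒≤ᵇ; ≤-trans; m≤m+n; m≤n+m; m≤m*n; m<m+n; ≰⇒>)
  open import Data.Nat.DivMod using (_%_; _/_; m%n<n; m≡m%n+[m/n]*n)
  open import Data.Nat.Divisibility using (_∣?_; divides)
  open import Data.Nat.Tactic.RingSolver using (solve-∀)
  open import Data.Integer as ℤ using (ℤ; +_; -[1+_]; +≤+; +<+)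
  open import Data.Integer.Properties using (pos-+; pos-*; +-injective; [+m]-[+n]≡m⊖n; ⊖-≥)
  open import Data.Integer.Tactic.RingSolver as ℤ-Solver using ()
  open ≡-Reasoning

  -- peel d p f r: can r be written as r′ + x·d with x ≤ f and p r′ true?
  peel : ℕ → (ℕ → Bool) → ℕ → ℕ → Bool
  peel d p zero    r = p r
  peel d p (suc f) r = p r ∨ ((d ≤ᵇ r) ∧ peel d p f (r ∸ d))

  +-suc-multiple : ∀ r x d → r + suc x * d ≡ r + x * d + d
  +-suc-multiple r x d = trans (cong (λ y → r + y) (+-comm d (x * d))) (sym (+-assoc r (x * d) d))

  peel-sound : ∀ {d p} {P : ℕ → Set} → (∀ r → T (p r) → P r) →
               ∀ f r → T (peel d p f r) → ∃₂ λ r′ x → P r′ × r′ + x * d ≡ r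
  peel-sound p-sound zero r pr = r , 0 , p-sound r pr , +-identityʳ r
  peel-sound {d} {p} p-sound (suc f) r t with Equivalence.to (T-∨ {p r}) t
  ... | inj₁ pr = r , 0 , p-sound r pr , +-identityʳ r
  ... | inj₂ t′ with Equivalence.to (T-∧ {d ≤ᵇ r}) t′
  ... | d≤r , rest with peel-sound p-sound f (r ∸ d) rest
  ... | r′ , x , Pr′ , eq = r′ , suc x , Pr′ , (begin
    r′ + suc x * d  ≡⟨ +-suc-multiple r′ x d ⟩
    r′ + x * d + d  ≡⟨ cong (_+ d) eq ⟩
    r ∸ d + d       ≡⟨ m∸n+n≡m (≤ᵇ⇒≤ d r d≤r) ⟩
    r               ∎)

  peel-complete : ∀ {d p} f r′ x → x ≤ f → T (p r′) → T (peel d p f (r′ + x * d))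
  peel-complete {p = p} zero r′ zero _ pr = subst (T ∘ p) (sym (+-identityʳ r′)) pr
  peel-complete {p = p} (suc f) r′ zero _ pr =
    Equivalence.from T-∨ (inj₁ (subst (T ∘ p) (sym (+-identityʳ r′)) pr))
  peel-complete {d} {p} (suc f) r′ (suc x) (s≤s x≤f) pr =
    Equivalence.from (T-∨ {p r}) (inj₂ (Equivalence.from T-∧ (≤⇒≤ᵇ d≤r , rest)))
    where
    r = r′ + suc x * d
    d≤r : d ≤ r
    d≤r = ≤-trans (m≤m+n d (x * d)) (m≤n+m (suc x * d) r′)
    r∸d : r′ + x * d ≡ r ∸ d
    r∸d = sym (trans (cong (_∸ d) (+-suc-multiple r′ x d)) (m+n∸n≡m (r′ + x * d) d))
    rest : T (peel d p f (r ∸ d))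
    rest = subst (T ∘ peel d p f) r∸d (peel-complete f r′ x x≤f pr)

  -- A coefficient can be chosen no larger than the term it contributes
  -- (this only matters for d = 0); it bounds the fuel a search needs.
  small-coefficient : ∀ x d → ∃ λ x′ → x′ * d ≡ x * d × x′ ≤ x * d
  small-coefficient x zero    = 0 , sym (*-zeroʳ x) , z≤n
  small-coefficient x (suc d) = x , refl , m≤m*n x (suc d)

  peel-complete-self : ∀ {d p} r′ x → T (p r′) → T (peel d p (r′ + x * d) (r′ + x * d))
  peel-complete-self {d} {p} r′ x pr with small-coefficient x d
  ... | x′ , same , x′≤ =
    subst (T ∘ peel d p (r′ + x * d)) (cong (λ y → r′ + y) same)
          (peel-complete (r′ + x * d) r′ x′ (≤-trans x′≤ (m≤n+m (x * d) r′)) pr)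

  regroup : ∀ x₁ x₂ x₃ y₁ y₂ y₃ a b c →
    (x₁ + y₁) * a + (x₂ + y₂) * b + (x₃ + y₃) * c ≡
    (x₁ * a + x₂ * b + x₃ * c) + (y₁ * a + y₂ * b + y₃ * c)
  regroup = solve-∀

  i+[j-i]≡j : ∀ i j → i ℤ.+ (j ℤ.- i) ≡ j
  i+[j-i]≡j = ℤ-Solver.solve-∀

  i+j-i≡j : ∀ i j → i ℤ.+ j ℤ.- i ≡ j
  i+j-i≡j = ℤ-Solver.solve-∀

  module Semigroup (a b c : ℕ) where

    infix 4 _∈S _∈S? _∈Sℤ

    _∈S : ℕ → Set
    n ∈S = ∃ λ x₁ → ∃ λ x₂ → ∃ λ x₃ → x₁ * a + x₂ * b + x₃ * c ≡ n

    InA InAB : ℕ → Set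
    InA r = ∃ λ x₁ → x₁ * a ≡ r
    InAB r = ∃₂ λ x₁ x₂ → x₁ * a + x₂ * b ≡ r

    inA inAB member : ℕ → Bool
    inA r = ⌊ a ∣? r ⌋
    inAB r = peel b inA r r
    member n = peel c inAB n n

    inA-sound : ∀ r → T (inA r) → InA r
    inA-sound r t with toWitness {a? = a ∣? r} t
    ... | divides x₁ eq = x₁ , sym eq

    inAB-sound : ∀ r → T (inAB r) → InAB r
    inAB-sound r t with peel-sound {d = b} inA-sound r r t
    ... | _ , x₂ , (x₁ , refl) , eq = x₁ , x₂ , eq

    member-sound : ∀ n → T (member n) → n ∈S
    member-sound n t with peel-sound {d = c} inAB-sound n n t
    ... | _ , x₃ , (x₁ , x₂ , refl) , eq = x₁ , x₂ , x₃ , eq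

    member-complete : ∀ n → n ∈S → T (member n)
    member-complete _ (x₁ , x₂ , x₃ , refl) =
      peel-complete-self (x₁ * a + x₂ * b) x₃
        (peel-complete-self (x₁ * a) x₂ (fromWitness {a? = a ∣? (x₁ * a)} (divides x₁ refl)))

    _∈S? : Decidable _∈S
    n ∈S? = map′ (member-sound n) (member-complete n) (T? (member n))

    0∈S : 0 ∈S
    0∈S = 0 , 0 , 0 , refl

    +-closed : ∀ {m n} → m ∈S → n ∈S → m + n ∈S
    +-closed (x₁ , x₂ , x₃ , refl) (y₁ , y₂ , y₃ , refl) =
      x₁ + y₁ , x₂ + y₂ , x₃ + y₃ , regroup x₁ x₂ x₃ y₁ y₂ y₃ a b c

    multiple-of-a : ∀ q → q * a ∈S
    multiple-of-a q = q , 0 , 0 , trans (+-identityʳ _) (+-identityʳ (q * a))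

    -- If the window F+1, …, F+a lies in S, so does every n > F:
    -- n = (F+1+r) + q·a with r < a the remainder of n − (F+1) modulo a.
    beyond : ∀ {F} .{{_ : NonZero a}} → (∀ {i} → i < a → suc F + i ∈S) →
             ∀ {n} → F < n → n ∈S
    beyond {F} window {n} F<n =
      subst _∈S decompose (+-closed (window (m%n<n i a)) (multiple-of-a (i / a)))
      where
      i = n ∸ suc F
      decompose : suc F + i % a + i / a * a ≡ n
      decompose = begin
        suc F + i % a + i / a * a    ≡⟨ +-assoc (suc F) (i % a) (i / a * a) ⟩
        suc F + (i % a + i / a * a)  ≡⟨ cong (λ y → suc F + y) (m≡m%n+[m/n]*n i a) ⟨
        suc F + i                    ≡⟨ m+[n∸m]≡n F<n ⟩
        n                            ∎

    _∈Sℤ : ℤ → Set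
    s ∈Sℤ = s ∈S[ + a , + b , + c ]

    embed : ∀ x₁ x₂ x₃ →
      + (x₁ * a + x₂ * b + x₃ * c) ≡ + x₁ ℤ.* + a ℤ.+ + x₂ ℤ.* + b ℤ.+ + x₃ ℤ.* + c
    embed x₁ x₂ x₃ = begin
      + (x₁ * a + x₂ * b + x₃ * c)              ≡⟨ pos-+ (x₁ * a + x₂ * b) (x₃ * c) ⟩
      + (x₁ * a + x₂ * b) ℤ.+ + (x₃ * c)        ≡⟨ cong₂ ℤ._+_ (pos-+ (x₁ * a) (x₂ * b)) (pos-* x₃ c) ⟩
      + (x₁ * a) ℤ.+ + (x₂ * b) ℤ.+ + x₃ ℤ.* + c
        ≡⟨ cong (λ y → y ℤ.+ + x₃ ℤ.* + c) (cong₂ ℤ._+_ (pos-* x₁ a) (pos-* x₂ b)) ⟩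
      + x₁ ℤ.* + a ℤ.+ + x₂ ℤ.* + b ℤ.+ + x₃ ℤ.* + c ∎

    ∈Sℤ⇒∈S : ∀ {s} → s ∈Sℤ → ∃ λ n → s ≡ + n × n ∈S
    ∈Sℤ⇒∈S (x₁ , x₂ , x₃ , refl) = _ , sym (embed x₁ x₂ x₃) , (x₁ , x₂ , x₃ , refl)

    ∈S⇒∈Sℤ : ∀ {n} → n ∈S → + n ∈Sℤ
    ∈S⇒∈Sℤ (x₁ , x₂ , x₃ , refl) = x₁ , x₂ , x₃ , sym (embed x₁ x₂ x₃)

    +∈Sℤ⇒∈S : ∀ {n} → + n ∈Sℤ → n ∈S
    +∈Sℤ⇒∈S n∈S with ∈Sℤ⇒∈S n∈S
    ... | _ , refl , n∈S′ = n∈S′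

    ExactlyOne : ℕ → ℕ → Set
    ExactlyOne m n = (m ∈S × ¬ n ∈S) ⊎ (¬ m ∈S × n ∈S)

    exactlyOne? : ∀ m n → Dec (ExactlyOne m n)
    exactlyOne? m n = (m ∈S? ×-dec ¬? (n ∈S?)) ⊎-dec (¬? (m ∈S?) ×-dec n ∈S?)

    Certificate : ℕ → Set
    Certificate F =
      0 < F × (∀ {i} → i < a → suc F + i ∈S) × (∀ {s} → s < suc F → ExactlyOne s (F ∸ s))

    certificate? : ∀ F → Dec (Certificate F)
    certificate? F =
      (0 <? F) ×-dec allUpTo? (λ i → suc F + i ∈S?) a
               ×-dec allUpTo? (λ s → exactlyOne? s (F ∸ s)) (suc F)

    F-n≡F∸n : ∀ {F n} → n ≤ F → + F ℤ.- + n ≡ + (F ∸ n)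
    F-n≡F∸n {F} {n} n≤F = trans ([+m]-[+n]≡m⊖n F n) (⊖-≥ n≤F)

    symmetric : ∀ F .{{_ : NonZero a}} → Certificate F → Symmetric (+ a) (+ b) (+ c)
    symmetric F (0<F , window , duality) =
      + F , (+≤+ 0<F , F∉S ∘ +∈Sℤ⇒∈S , above) , λ s → mk⇔ (to s) (from s)
      where
      F∉S : ¬ F ∈S
      F∉S with duality {0} (s≤s z≤n)
      ... | inj₁ (_ , F∉S′) = F∉S′
      ... | inj₂ (0∉S , _)  = contradiction 0∈S 0∉S

      above : ∀ s → + F ℤ.< s → s ∈Sℤ
      above (+ n) (+<+ F<n) = ∈S⇒∈Sℤ (beyond window F<n)

      -- s and F − s cannot both lie in S, since their sum F does not.
      to : ∀ s → s ∈Sℤ → ¬ (+ F ℤ.- s) ∈Sℤ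
      to s s∈S F-s∈S with ∈Sℤ⇒∈S s∈S | ∈Sℤ⇒∈S F-s∈S
      ... | m , refl , m∈S | n , F-m≡n , n∈S = F∉S (subst _∈S m+n≡F (+-closed m∈S n∈S))
        where
        m+n≡F : m + n ≡ F
        m+n≡F = +-injective (begin
          + (m + n)                ≡⟨ pos-+ m n ⟩
          + m ℤ.+ + n              ≡⟨ cong (λ y → + m ℤ.+ y) F-m≡n ⟨
          + m ℤ.+ (+ F ℤ.- + m)    ≡⟨ i+[j-i]≡j (+ m) (+ F) ⟩
          + F                      ∎)

      -- If F − s ∉ S then s ∈ S: by duality for 0 ≤ s ≤ F, by the window
      -- for s > F, and for s < 0 the hypothesis fails as F − s > F.
      from : ∀ s → ¬ (+ F ℤ.- s) ∈Sℤ → s ∈Sℤ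
      from (+ n) F-n∉S with n ≤? F
      ... | no n≰F = above (+ n) (+<+ (≰⇒> n≰F))
      ... | yes n≤F with duality (s≤s n≤F)
      ...   | inj₁ (n∈S , _)   = ∈S⇒∈Sℤ n∈S
      ...   | inj₂ (_ , F∸n∈S) =
        contradiction (subst _∈Sℤ (sym (F-n≡F∸n n≤F)) (∈S⇒∈Sℤ F∸n∈S)) F-n∉S
      from -[1+ n ] F+n∉S =
        contradiction (above (+ (F + suc n)) (+<+ (m<m+n F (s≤s z≤n)))) F+n∉S

open NaturalMembership using (module Semigroup; i+[j-i]≡j; i+j-i≡j)

open import Data.Integer using (ℤ; +_; -[1+_]; ∣_∣; 0ℤ; -_; _+_; _*_; _-_; _≤_; _≤?_)
open import Data.Integer.Properties using (i≤j⇒0≤j-i; 0≤i⇒+∣i∣≡i; +-monoˡ-≤; drop‿+≤+)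

CertificateFor : ℕ → ℤ → ℤ → ℕ → Set
CertificateFor a b c F = 0ℤ ≤ b × 0ℤ ≤ c × Semigroup.Certificate a ∣ b ∣ ∣ c ∣ F

certificateFor? : ∀ a b c F → Dec (CertificateFor a b c F)
certificateFor? a b c F = (0ℤ ≤? b) ×-dec (0ℤ ≤? c) ×-dec Semigroup.certificate? a ∣ b ∣ ∣ c ∣ F

symmetric-ℤ : ∀ a b c F .{{_ : NonZero a}} → CertificateFor a b c F → Symmetric (+ a) b c
symmetric-ℤ a b c F (0≤b , 0≤c , certificate) =
  subst₂ (Symmetric (+ a)) (0≤i⇒+∣i∣≡i 0≤b) (0≤i⇒+∣i∣≡i 0≤c)
         (Semigroup.symmetric a ∣ b ∣ ∣ c ∣ F certificate)

reindex : ∀ lo m {k} → lo ≤ k → k ≤ lo + + m → ∃ λ n → n ℕ.≤ m × k ≡ lo + + n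
reindex lo m {k} lo≤k k≤hi = ∣ k - lo ∣ , n≤m , k≡lo+n
  where
  open Data.Integer.Properties.≤-Reasoning
  n≡k-lo : + ∣ k - lo ∣ ≡ k - lo
  n≡k-lo = 0≤i⇒+∣i∣≡i (i≤j⇒0≤j-i lo≤k)
  k≡lo+n : k ≡ lo + + ∣ k - lo ∣
  k≡lo+n = trans (sym (i+[j-i]≡j lo k)) (cong (λ i → lo + i) (sym n≡k-lo))
  n≤m : ∣ k - lo ∣ ℕ.≤ m
  n≤m = drop‿+≤+ (begin
    + ∣ k - lo ∣       ≡⟨ n≡k-lo ⟩
    k - lo             ≤⟨ +-monoˡ-≤ (- lo) k≤hi ⟩
    lo + + m - lo      ≡⟨ i+j-i≡j lo (+ m) ⟩
    + m                ∎)

symmetric-on-range : ∀ a .{{_ : NonZero a}} (b c : ℤ → ℤ) (F : ℕ → ℕ) lo m →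
  (∀ {n} → n ℕ.< suc m → CertificateFor a (b (lo + + n)) (c (lo + + n)) (F n)) →
  ∀ k → lo ≤ k → k ≤ lo + + m → Symmetric (+ a) (b k) (c k)
symmetric-on-range a b c F lo m certificates k lo≤k k≤hi with reindex lo m lo≤k k≤hi
... | n , n≤m , refl = symmetric-ℤ a (b (lo + + n)) (c (lo + + n)) (F n) (certificates (ℕ.s≤s n≤m))

-- The two families of generators, and their Frobenius numbers indexed by
-- n = k − lo: 89 up to k = 14 and then 12 less with each further step of k
-- for the first family; 167 up to k = 7 and then 72 less per step for the
-- second.
b₁ c₁ b₂ c₂ : ℤ → ℤ
b₁ k = + 6 + + 4 * k
c₁ k = + 87 - + 4 * k
b₂ k = + 3 + + 9 * k
c₂ k = + 85 - + 9 * k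

frobenius₁ frobenius₂ : ℕ → ℕ
frobenius₁ n = 89 ℕ.∸ 12 ℕ.* (n ℕ.∸ 15)
frobenius₂ n = 167 ℕ.∸ 72 ℕ.* (n ℕ.∸ 7)

certificates₁ : ∀ {n} → n ℕ.< 23 →
  CertificateFor 4 (b₁ (-[1+ 0 ] + + n)) (c₁ (-[1+ 0 ] + + n)) (frobenius₁ n)
certificates₁ = toWitness {a? = allUpTo? (λ n →
  certificateFor? 4 (b₁ (-[1+ 0 ] + + n)) (c₁ (-[1+ 0 ] + + n)) (frobenius₁ n)) 23} tt

certificates₂ : ∀ {n} → n ℕ.< 10 →
  CertificateFor 9 (b₂ (+ 0 + + n)) (c₂ (+ 0 + + n)) (frobenius₂ n)
certificates₂ = toWitness {a? = allUpTo? (λ n →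
  certificateFor? 9 (b₂ (+ 0 + + n)) (c₂ (+ 0 + + n)) (frobenius₂ n)) 10} tt

mainTheorem2 : ((k : ℤ) → -[1+ 0 ] ≤ k → k ≤ + 21 →
    Symmetric (+ 4) (+ 6 + + 4 * k) (+ 87 - + 4 * k))
    ×
    ((k : ℤ) → + 0 ≤ k → k ≤ + 9 →
    Symmetric (+ 9) (+ 3 + + 9 * k) (+ 85 - + 9 * k))
mainTheorem2 =
  symmetric-on-range 4 b₁ c₁ frobenius₁ -[1+ 0 ] 22 certificates₁ ,
  symmetric-on-range 9 b₂ c₂ frobenius₂ (+ 0) 9 certificates₂
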